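{- Let $n\ge 2$ and let $\mathbf{Y}\subseteq\mathcal{M}_n$. Then the edge surplus of the induced rotation system $W_n[\mathcal{P}_n\cup\mathbf{Y}]$ equals $(n-2)|\mathbf{Y}|-(n-1)!+1$.
   Context: The edge surplus of a graph (or rotation system) with vertex set $V$ and edge set $E$ is $|E|-|V|+1$. $\mathcal{P}_n$ is the set of classes under cyclic rotation of permutation strings $p_1\cdots p_n$ of $\{1,\dots,n\}$; $\mathcal{M}_n$ is the set of rotation classes of strings of length $n-1$ of distinct symbols from $\{1,\dots,n\}$. Wilf's graph has vertex set $\mathcal{P}_n\cup\mathcal{M}_n$ with an edge between $X\in\mathcal{P}_n$ and $Y\in\mathcal{M}_n$ iff $X=[p_1\cdots p_n]$ and $Y=[p_2\cdots p_n]$ for some permutation string; $W_n$ is this graph equipped with cyclic edge orders, and $W_n[U]$ denotes the subgraph induced on the vertex set $U$ (with restricted orders). -}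

module Defs where

open import Data.Nat using (ℕ; zero; suc; _∸_)
open import Data.Fin using (Fin)
open import Data.Fin.Properties using () renaming (_≟_ to _≟ᶠ_)
open import Data.List using (List; []; _∷_; _++_; [_]; length; filter; cartesianProduct)
open import Data.List.Properties using (≡-dec)
open import Data.List.Relation.Unary.Any using (Any; any?)
open import Data.List.Relation.Unary.All using (All)
open import Data.List.Relation.Unary.Unique.Propositional using (Unique)
open import Data.List.Relation.Unary.AllPairs using (AllPairs)
open import Data.Product using (_×_; _,_)
open import Relation.Binary.PropositionalEquality using (_≡_)
open import Relation.Nullary using (¬_; Dec)

Str : ℕ → Set
Str n = List (Fin n)

rot1 : ∀ {n} → Str n → Str n
rot1 []       = []
rot1 (x ∷ xs) = xs ++ [ x ]

rotsFrom : ∀ {n} → ℕ → Str n → List (Str n)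
rotsFrom zero    xs = [ xs ]
rotsFrom (suc k) xs = xs ∷ rotsFrom k (rot1 xs)

rotations : ∀ {n} → Str n → List (Str n)
rotations xs = rotsFrom (length xs) xs

RotEq : ∀ {n} → Str n → Str n → Set
RotEq xs ys = Any (ys ≡_) (rotations xs)

rotEq? : ∀ {n} (xs ys : Str n) → Dec (RotEq xs ys)
rotEq? xs ys = any? (λ zs → ≡-dec _≟ᶠ_ ys zs) (rotations xs)

IsPermStr : (n : ℕ) → Str n → Set
IsPermStr n p = length p ≡ n × Unique p

IsMStr : (n : ℕ) → Str n → Set
IsMStr n s = length s ≡ n ∸ 1 × Unique s

-- Ps is a list of representatives of the classes of 𝒫ₙ, one per class
IsPClassReps : (n : ℕ) → List (Str n) → Set
IsPClassReps n Ps =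
  All (IsPermStr n) Ps ×
  AllPairs (λ a b → ¬ RotEq a b) Ps ×
  (∀ p → IsPermStr n p → Any (RotEq p) Ps)

-- Ys is a list of representatives of pairwise distinct classes of ℳₙ
-- (i.e. a subset 𝐘 ⊆ ℳₙ, with |𝐘| = length Ys)
IsMClassSubset : (n : ℕ) → List (Str n) → Set
IsMClassSubset n Ys =
  All (IsMStr n) Ys × AllPairs (λ a b → ¬ RotEq a b) Ys

tail : ∀ {n} → Str n → Str n
tail []       = []
tail (_ ∷ xs) = xs

-- Wilf adjacency between [X] ∈ 𝒫ₙ and [Y] ∈ ℳₙ:
-- there is a permutation string p with [p] = [X] (p a rotation of X)
-- and [p2...pn] = [Y].
WilfAdj : ∀ {n} → Str n → Str n → Set
WilfAdj X Y = Any (λ p → RotEq (tail p) Y) (rotations X)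

wilfAdj? : ∀ {n} (e : Str n × Str n) → Dec (WilfAdj (Data.Product.proj₁ e) (Data.Product.proj₂ e))
wilfAdj? (X , Y) = any? (λ p → rotEq? (tail p) Y) (rotations X)

-- number of edges of W_n[𝒫ₙ ∪ 𝐘]: edges only join 𝒫ₙ and ℳₙ
edgeCount : ∀ {n} → List (Str n) → List (Str n) → ℕ
edgeCount Ps Ys = length (filter wilfAdj? (cartesianProduct Ps Ys))

vertexCount : ∀ {n} → List (Str n) → List (Str n) → ℕ
vertexCount Ps Ys = length Ps Data.Nat.+ length Ys

open import Data.Integer using (ℤ; +_; _-_) renaming (_+_ to _+ℤ_)

edgeSurplus : ∀ {n} → List (Str n) → List (Str n) → ℤ
edgeSurplus Ps Ys = (+ edgeCount Ps Ys - + vertexCount Ps Ys) +ℤ + 1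

-- All edges of W_n join 𝒫ₙ to ℳₙ, so it suffices that |𝒫ₙ| = (n−1)! and that every [Y] ∈ ℳₙ has
-- exactly n − 1 neighbours; then |E| − |V| + 1 = (n−1)|𝐘| − (n−1)! − |𝐘| + 1. Both facts are one count:
-- if s₁, …, s_m are pairwise non-rotation-equivalent permutation strings, exactly m classes of 𝒫ₙ
-- contain one of them. For |𝒫ₙ| take the strings 0 q, q running over the (n−1)! arrangements of the
-- other symbols, since every class contains exactly one string starting with 0. For [Y], let μ be the
-- symbol missing from Y: a permutation string p₁ t with t a rotation of Y must have p₁ = μ, so the
-- neighbours of [Y] are the classes of μ t for the n − 1 distinct rotations t of Y.

module Submission where

open import Defs
open import Data.Empty using (⊥-elim)
open import Data.Nat using (ℕ; zero; suc; _∸_; _!; _≤_; z≤n; s≤s)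
open import Data.Nat.Properties using (suc-injective)
open import Data.Fin using (Fin; punchIn; punchOut)
open import Data.Fin.Properties using (punchIn-injective; punchInᵢ≢i; punchIn-punchOut)
  renaming (_≟_ to _≟ᶠ_)
open import Data.List using (List; []; _∷_; _++_; [_]; length; map; drop; filter; allFin; cartesianProduct; cartesianProductWith)
open import Data.List.Properties
  using (++-assoc; ++-identityʳ; ++-cancelˡ; ∷-injectiveˡ; ∷-injectiveʳ; length-map; length-++; map-injective;
         length-tabulate; length-++-≤ˡ; filter-++; filter-all; filter-none; cartesianProductWith-zeroʳ)
open import Data.List.Membership.Propositional using (_∈_; _∉_; find; lose)
open import Data.List.Membership.Propositional.Properties
  using (∈-map⁺; ∈-map⁻; ∈-++⁺ʳ; ∈-∃++; ∈-allFin; ∈-cartesianProductWith⁺; ∈-cartesianProductWith⁻)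
open import Data.List.Relation.Unary.Any as Any using (Any; here; there; any?)
open import Data.List.Relation.Unary.All as All using (All; []; _∷_)
import Data.List.Relation.Unary.All.Properties as All
open import Data.List.Relation.Unary.AllPairs using (AllPairs; []; _∷_)
import Data.List.Relation.Unary.AllPairs.Properties as AllPairs
open import Data.List.Relation.Unary.Unique.Propositional using (Unique)
import Data.List.Relation.Unary.Unique.Propositional.Properties as Unique
open import Data.List.Relation.Unary.Unique.Propositional.Properties using (Unique[x∷xs]⇒x∉xs)
open import Data.List.Relation.Binary.Permutation.Propositional using (_↭_; ↭⇒↭ₛ)
open import Data.List.Relation.Binary.Permutation.Propositional.Properties using (++-comm; ↭-length; ∈-resp-↭)
import Data.List.Relation.Binary.Permutation.Setoid.Properties as Permutationₛ
open import Data.Product using (∃; ∃₂; _×_; _,_; proj₁; proj₂; map₁)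
open import Data.Sum using (_⊎_; inj₁; inj₂)
open import Level using (0ℓ)
open import Relation.Nullary using (¬_; yes; no)
open import Relation.Nullary.Decidable using (_⊎-dec_)
open import Relation.Unary using (Pred; Decidable)
open import Relation.Binary using (Rel; IsDecEquivalence)
open import Relation.Binary.PropositionalEquality hiding ([_])

private variable
  A B C : Set

allPairs-mapWith-All : {P : Pred A 0ℓ} {R S : Rel A 0ℓ} → (∀ {x y} → P x → P y → R x y → S x y) →
  ∀ {xs} → All P xs → AllPairs R xs → AllPairs S xs
allPairs-mapWith-All f [] [] = []
allPairs-mapWith-All f (px ∷ pxs) (rx ∷ rxs) =
  All.zipWith (λ (py , r) → f px py r) (pxs , rx) ∷ allPairs-mapWith-All f pxs rxs

module Counting where

  open import Data.Nat using (_+_; _*_)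
  open import Data.Nat.Properties using (+-suc; +-commutativeSemigroup)
  open import Algebra.Properties.CommutativeSemigroup +-commutativeSemigroup using (x∙yz≈y∙xz)

  count : {P : Pred A 0ℓ} → Decidable P → List A → ℕ
  count P? xs = length (filter P? xs)

  count-++ : {P : Pred A 0ℓ} (P? : Decidable P) (xs ys : List A) → count P? (xs ++ ys) ≡ count P? xs + count P? ys
  count-++ P? xs ys = trans (cong length (filter-++ P? xs ys)) (length-++ (filter P? xs))

  count-all : {P : Pred A 0ℓ} (P? : Decidable P) {xs : List A} → All P xs → count P? xs ≡ length xs
  count-all P? pxs = cong length (filter-all P? pxs)

  count-none : {P : Pred A 0ℓ} (P? : Decidable P) {xs : List A} → All (λ x → ¬ P x) xs → count P? xs ≡ 0
  count-none P? ¬pxs = cong length (filter-none P? ¬pxs)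

  count-cong : {P Q : Pred A 0ℓ} (P? : Decidable P) (Q? : Decidable Q) {xs : List A} →
    All (λ x → (P x → Q x) × (Q x → P x)) xs → count P? xs ≡ count Q? xs
  count-cong P? Q? [] = refl
  count-cong P? Q? {x ∷ _} ((f , g) ∷ fgs) with P? x | Q? x
  ... | yes _ | yes _ = cong suc (count-cong P? Q? fgs)
  ... | yes p | no ¬q = ⊥-elim (¬q (f p))
  ... | no ¬p | yes q = ⊥-elim (¬p (g q))
  ... | no _  | no _  = count-cong P? Q? fgs

  count-⊎ : {P Q : Pred A 0ℓ} (P? : Decidable P) (Q? : Decidable Q) {xs : List A} → All (λ x → ¬ (P x × Q x)) xs →
    count (λ x → P? x ⊎-dec Q? x) xs ≡ count P? xs + count Q? xs
  count-⊎ P? Q? [] = refl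
  count-⊎ P? Q? {x ∷ _} (disjoint ∷ disjoints) with P? x | Q? x
  ... | yes p | yes q = ⊥-elim (disjoint (p , q))
  ... | yes _ | no _  = cong suc (count-⊎ P? Q? disjoints)
  ... | no _  | yes _ = trans (cong suc (count-⊎ P? Q? disjoints)) (sym (+-suc _ _))
  ... | no _  | no _  = count-⊎ P? Q? disjoints

  length-cartesianProductWith : (f : A → B → C) (xs : List A) (ys : List B) →
    length (cartesianProductWith f xs ys) ≡ length xs * length ys
  length-cartesianProductWith f [] ys = refl
  length-cartesianProductWith f (x ∷ xs) ys =
    trans (length-++ (map (f x) ys)) (cong₂ _+_ (length-map (f x) ys) (length-cartesianProductWith f xs ys))

  count-++-+ˡ : {P : Pred A 0ℓ} (P? : Decidable P) (r : List A) {u v : List A} {c : ℕ} →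
    count P? u ≡ c + count P? v → count P? (r ++ u) ≡ c + count P? (r ++ v)
  count-++-+ˡ P? r {u} {v} {c} u≡c+v = begin
    count P? (r ++ u)             ≡⟨ count-++ P? r u ⟩
    count P? r + count P? u       ≡⟨ cong (count P? r +_) u≡c+v ⟩
    count P? r + (c + count P? v) ≡⟨ x∙yz≈y∙xz (count P? r) c _ ⟩
    c + (count P? r + count P? v) ≡⟨ cong (c +_) (count-++ P? r v) ⟨
    c + count P? (r ++ v)         ∎
    where open ≡-Reasoning

  count-cartesianProduct-∷ʳ : {P : Pred (A × B) 0ℓ} (P? : Decidable P) (xs : List A) (y : B) (ys : List B) →
    count P? (cartesianProduct xs (y ∷ ys)) ≡ count (λ x → P? (x , y)) xs + count P? (cartesianProduct xs ys)
  count-cartesianProduct-∷ʳ P? [] y ys = refl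
  count-cartesianProduct-∷ʳ P? (x ∷ xs) y ys
    with P? (x , y) | count-++-+ˡ P? (map (x ,_) ys) (count-cartesianProduct-∷ʳ P? xs y ys)
  ... | yes _ | shift = cong suc shift
  ... | no _  | shift = shift

  count-cartesianProduct-regular : {P : Pred (A × B) 0ℓ} (P? : Decidable P) (xs : List A) {d : ℕ} (ys : List B) →
    All (λ y → count (λ x → P? (x , y)) xs ≡ d) ys → count P? (cartesianProduct xs ys) ≡ length ys * d
  count-cartesianProduct-regular P? xs [] [] = cong (count P?) (cartesianProductWith-zeroʳ _,_ xs)
  count-cartesianProduct-regular P? xs (y ∷ ys) (deg ∷ degs) =
    trans (count-cartesianProduct-∷ʳ P? xs y ys) (cong₂ _+_ deg (count-cartesianProduct-regular P? xs ys degs))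

open Counting

Rotation : List A → List A → Set
Rotation xs ys = ∃₂ λ a b → xs ≡ a ++ b × ys ≡ b ++ a

++-levi : (a b c d : List A) → a ++ b ≡ c ++ d →
  (∃ λ e → c ≡ a ++ e × b ≡ e ++ d) ⊎ (∃ λ e → a ≡ c ++ e × d ≡ e ++ b)
++-levi []      b c       d eq = inj₁ (c , refl , eq)
++-levi (x ∷ a) b []      d eq = inj₂ (x ∷ a , refl , sym eq)
++-levi (x ∷ a) b (y ∷ c) d eq with refl ← ∷-injectiveˡ eq with ++-levi a b c d (∷-injectiveʳ eq)
... | inj₁ (e , refl , b≡ed) = inj₁ (e , refl , b≡ed)
... | inj₂ (e , refl , d≡eb) = inj₂ (e , refl , d≡eb)

rotation-refl : (xs : List A) → Rotation xs xs
rotation-refl xs = [] , xs , refl , sym (++-identityʳ xs)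

rotation-sym : {xs ys : List A} → Rotation xs ys → Rotation ys xs
rotation-sym (a , b , xs≡ab , ys≡ba) = b , a , ys≡ba , xs≡ab

rotation-trans : {xs ys zs : List A} → Rotation xs ys → Rotation ys zs → Rotation xs zs
rotation-trans (a , b , refl , ys≡ba) (c , d , ys≡cd , refl) with ++-levi b a c d (trans (sym ys≡ba) ys≡cd)
... | inj₁ (e , refl , refl) = e , d ++ b , ++-assoc e d b , sym (++-assoc d b e)
... | inj₂ (e , refl , refl) = a ++ c , e , sym (++-assoc a c e) , ++-assoc e a c

rotation-++-∷ : (a : List A) (x : A) (b : List A) → Rotation (a ++ x ∷ b) (x ∷ b ++ a)
rotation-++-∷ a x b = a , x ∷ b , refl , refl

rotation⇒↭ : {xs ys : List A} → Rotation xs ys → xs ↭ ys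
rotation⇒↭ (a , b , refl , refl) = ++-comm a b

Unique-resp-rotation : {xs ys : List A} → Rotation xs ys → Unique xs → Unique ys
Unique-resp-rotation {A = A} r = Permutationₛ.Unique-resp-↭ (setoid A) (↭⇒↭ₛ (rotation⇒↭ r))

length-rotation : {xs ys : List A} → Rotation xs ys → length ys ≡ length xs
length-rotation r = sym (↭-length (rotation⇒↭ r))

∉-resp-rotation : {x : A} {xs ys : List A} → Rotation xs ys → x ∉ xs → x ∉ ys
∉-resp-rotation r x∉xs x∈ys = x∉xs (∈-resp-↭ (rotation⇒↭ (rotation-sym r)) x∈ys)

rotation-∷-cancel : {x : A} {xs ys : List A} → Unique (x ∷ xs) → Rotation (x ∷ xs) (x ∷ ys) → xs ≡ ys
rotation-∷-cancel _ ([] , b , refl , eq) = sym (∷-injectiveʳ (trans eq (++-identityʳ _)))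
rotation-∷-cancel _ (a , [] , eq , refl) = ∷-injectiveʳ (trans eq (++-identityʳ _))
rotation-∷-cancel (x≢xs ∷ _) (z ∷ a , w ∷ b , eq , eq′)
  with refl ← ∷-injectiveˡ eq | refl ← ∷-injectiveˡ eq′ =
  ⊥-elim (All.lookup x≢xs (subst (_ ∈_) (sym (∷-injectiveʳ eq)) (∈-++⁺ʳ a (here refl))) refl)

Unique⇒prefix-≡ : {y : A} (a a′ : List A) {c c′ : List A} →
  Unique (a ++ y ∷ c) → a ++ y ∷ c ≡ a′ ++ y ∷ c′ → a ≡ a′
Unique⇒prefix-≡ []      []       _ _ = refl
Unique⇒prefix-≡ []      (z ∷ a′) (y≢c ∷ _) eq with refl ← ∷-injectiveˡ eq =
  ⊥-elim (All.lookup y≢c (subst (_ ∈_) (sym (∷-injectiveʳ eq)) (∈-++⁺ʳ a′ (here refl))) refl)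
Unique⇒prefix-≡ (z ∷ a) []       (z≢ac ∷ _) eq with refl ← ∷-injectiveˡ eq =
  ⊥-elim (All.lookup z≢ac (∈-++⁺ʳ a (here refl)) refl)
Unique⇒prefix-≡ (z ∷ a) (w ∷ a′) (_ ∷ ac!) eq with refl ← ∷-injectiveˡ eq =
  cong (z ∷_) (Unique⇒prefix-≡ a a′ ac! (∷-injectiveʳ eq))

Cut : List A → List A × A × List A → Set
Cut xs (a , y , c) = xs ≡ a ++ y ∷ c

cuts : List A → List (List A × A × List A)
cuts []       = []
cuts (x ∷ xs) = ([] , x , xs) ∷ map (map₁ (x ∷_)) (cuts xs)

cuts-sound : (xs : List A) → All (Cut xs) (cuts xs)
cuts-sound []       = []
cuts-sound (x ∷ xs) = refl ∷ All.map⁺ (All.map (cong (x ∷_)) (cuts-sound xs))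

∈-cuts : (a : List A) (y : A) (c : List A) → (a , y , c) ∈ cuts (a ++ y ∷ c)
∈-cuts []      y c = here refl
∈-cuts (x ∷ a) y c = there (∈-map⁺ (map₁ (x ∷_)) (∈-cuts a y c))

cuts-unique : (xs : List A) → Unique (cuts xs)
cuts-unique []       = []
cuts-unique (x ∷ xs) =
  All.map⁺ (All.universal (λ _ ()) (cuts xs)) ∷ Unique.map⁺ (cong (map₁ (drop 1))) (cuts-unique xs)

length-cuts : (xs : List A) → length (cuts xs) ≡ length xs
length-cuts []       = refl
length-cuts (x ∷ xs) = cong suc (trans (length-map (map₁ (x ∷_)) (cuts xs)) (length-cuts xs))

rotateAt : List A × A × List A → List A
rotateAt (a , y , c) = y ∷ c ++ a

rotateAt-injective : {xs : List A} {u v : List A × A × List A} →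
  Unique xs → Cut xs u → Cut xs v → rotateAt u ≡ rotateAt v → u ≡ v
rotateAt-injective {u = a , y , c} {a′ , _ , c′} xs! refl cut′ eq
  with refl ← ∷-injectiveˡ eq with refl ← Unique⇒prefix-≡ a a′ xs! cut′ =
  cong (λ c → a , y , c) (∷-injectiveʳ (++-cancelˡ a (y ∷ c) (y ∷ c′) cut′))

-- Unlike rotations, which lists xs itself twice, shifts lists each of the length xs rotations once.
shifts : List A → List (List A)
shifts xs = map rotateAt (cuts xs)

length-shifts : (xs : List A) → length (shifts xs) ≡ length xs
length-shifts xs = trans (length-map rotateAt (cuts xs)) (length-cuts xs)

shifts-unique : {xs : List A} → Unique xs → Unique (shifts xs)
shifts-unique {xs = xs} xs! = AllPairs.map⁺
  (allPairs-mapWith-All (λ cut cut′ u≢v eq → u≢v (rotateAt-injective xs! cut cut′ eq))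
    (cuts-sound xs) (cuts-unique xs))

∈-shifts⁻ : {xs t : List A} → t ∈ shifts xs → Rotation xs t
∈-shifts⁻ {xs = xs} t∈ with (a , y , c) , u∈ , refl ← ∈-map⁻ rotateAt t∈ =
  a , y ∷ c , All.lookup (cuts-sound xs) u∈ , refl

∈-shifts⁺ : {x : A} {xs t : List A} → Rotation (x ∷ xs) t → t ∈ shifts (x ∷ xs)
∈-shifts⁺ (a , [] , eq , refl) = here (trans (sym (++-identityʳ a)) (trans (sym eq) (sym (++-identityʳ _))))
∈-shifts⁺ (a , y ∷ c , eq , refl) = subst (λ zs → y ∷ c ++ a ∈ shifts zs) (sym eq) (∈-map⁺ rotateAt (∈-cuts a y c))

module Transversal {_≈_ : Rel A 0ℓ} (≈-isDecEquivalence : IsDecEquivalence _≈_) where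

  open import Data.Nat using (_+_)
  open IsDecEquivalence ≈-isDecEquivalence using (_≟_) renaming (sym to ≈-sym; trans to ≈-trans)

  Inequivalent : List A → Set
  Inequivalent = AllPairs (λ x y → ¬ x ≈ y)

  All-≉-resp-≈ : {x s : A} {ys : List A} → x ≈ s → All (λ y → ¬ x ≈ y) ys → All (λ y → ¬ y ≈ s) ys
  All-≉-resp-≈ x≈s = All.map (λ x≉y y≈s → x≉y (≈-trans x≈s (≈-sym y≈s)))

  count-≈ : {s : A} {xs : List A} → Inequivalent xs → Any (_≈ s) xs → count (_≟ s) xs ≡ 1
  count-≈ {s} {x ∷ xs} (x≉xs ∷ _) (here x≈s) with x ≟ s
  ... | yes _   = cong suc (count-none (_≟ s) (All-≉-resp-≈ x≈s x≉xs))
  ... | no x≉s  = ⊥-elim (x≉s x≈s)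
  count-≈ {s} {x ∷ xs} (x≉xs ∷ xs-inequivalent) (there xs∋s) with x ≟ s
  ... | yes x≈s = ⊥-elim (All.All¬⇒¬Any (All-≉-resp-≈ x≈s x≉xs) xs∋s)
  ... | no _    = count-≈ xs-inequivalent xs∋s

  count-meeting : {xs ss : List A} → Inequivalent xs → Inequivalent ss → All (λ s → Any (_≈ s) xs) ss →
    count (λ x → any? (x ≟_) ss) xs ≡ length ss
  count-meeting {xs} _ [] [] = count-none (λ x → any? (x ≟_) []) (All.universal (λ _ ()) xs)
  count-meeting {xs} {s ∷ ss} xs-inequivalent (s≉ss ∷ ss-inequivalent) (xs∋s ∷ xs∋ss) = begin
    count (λ x → any? (x ≟_) (s ∷ ss)) xs
      ≡⟨ count-cong _ _ (All.universal (λ _ → Any.toSum , Any.fromSum) xs) ⟩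
    count (λ x → (x ≟ s) ⊎-dec any? (x ≟_) ss) xs
      ≡⟨ count-⊎ (_≟ s) (λ x → any? (x ≟_) ss) (All.universal (λ _ → disjoint) xs) ⟩
    count (_≟ s) xs + count (λ x → any? (x ≟_) ss) xs
      ≡⟨ cong₂ _+_ (count-≈ xs-inequivalent xs∋s) (count-meeting xs-inequivalent ss-inequivalent xs∋ss) ⟩
    suc (length ss) ∎
    where
    open ≡-Reasoning
    disjoint : {x : A} → ¬ (x ≈ s × Any (x ≈_) ss)
    disjoint (x≈s , x≈ss) = All.All¬⇒¬Any (All.map (λ s≉t x≈t → s≉t (≈-trans (≈-sym x≈s) x≈t)) s≉ss) x≈ss

module _ {n : ℕ} where

  rot1^ : ℕ → Str n → Str n
  rot1^ zero    xs = xs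
  rot1^ (suc i) xs = rot1^ i (rot1 xs)

  rotation-rot1 : (xs : Str n) → Rotation xs (rot1 xs)
  rotation-rot1 []       = rotation-refl []
  rotation-rot1 (x ∷ xs) = [ x ] , xs , refl , refl

  rotation-rot1^ : (i : ℕ) (xs : Str n) → Rotation xs (rot1^ i xs)
  rotation-rot1^ zero    xs = rotation-refl xs
  rotation-rot1^ (suc i) xs = rotation-trans (rotation-rot1 xs) (rotation-rot1^ i (rot1 xs))

  rot1^-++ : (a b : Str n) → rot1^ (length a) (a ++ b) ≡ b ++ a
  rot1^-++ []      b = sym (++-identityʳ b)
  rot1^-++ (x ∷ a) b = begin
    rot1^ (length a) ((a ++ b) ++ [ x ]) ≡⟨ cong (rot1^ (length a)) (++-assoc a b [ x ]) ⟩
    rot1^ (length a) (a ++ b ++ [ x ])   ≡⟨ rot1^-++ a (b ++ [ x ]) ⟩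
    (b ++ [ x ]) ++ a                    ≡⟨ ++-assoc b [ x ] a ⟩
    b ++ x ∷ a                           ∎
    where open ≡-Reasoning

  ∈-rotsFrom⁻ : (k : ℕ) (xs : Str n) {ys : Str n} → ys ∈ rotsFrom k xs → ∃ λ i → ys ≡ rot1^ i xs
  ∈-rotsFrom⁻ zero    xs (here refl) = 0 , refl
  ∈-rotsFrom⁻ (suc k) xs (here refl) = 0 , refl
  ∈-rotsFrom⁻ (suc k) xs (there ys∈) with i , refl ← ∈-rotsFrom⁻ k (rot1 xs) ys∈ = suc i , refl

  ∈-rotsFrom⁺ : {i k : ℕ} (xs : Str n) → i ≤ k → rot1^ i xs ∈ rotsFrom k xs
  ∈-rotsFrom⁺ {k = zero}  xs z≤n      = here refl
  ∈-rotsFrom⁺ {k = suc k} xs z≤n      = here refl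
  ∈-rotsFrom⁺ {k = suc k} xs (s≤s i≤k) = there (∈-rotsFrom⁺ (rot1 xs) i≤k)

  RotEq⇒Rotation : {xs ys : Str n} → RotEq xs ys → Rotation xs ys
  RotEq⇒Rotation {xs} ys∈ with i , refl ← ∈-rotsFrom⁻ (length xs) xs ys∈ = rotation-rot1^ i xs

  Rotation⇒RotEq : {xs ys : Str n} → Rotation xs ys → RotEq xs ys
  Rotation⇒RotEq (a , b , refl , refl) =
    subst (_∈ rotations (a ++ b)) (rot1^-++ a b) (∈-rotsFrom⁺ (a ++ b) (length-++-≤ˡ a))

  IsPermStr-resp-rotation : {xs ys : Str n} → Rotation xs ys → IsPermStr n xs → IsPermStr n ys
  IsPermStr-resp-rotation r (len , xs!) = trans (length-rotation r) len , Unique-resp-rotation r xs!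

  rotEq-sym : {xs ys : Str n} → RotEq xs ys → RotEq ys xs
  rotEq-sym r = Rotation⇒RotEq (rotation-sym (RotEq⇒Rotation r))

  rotEq-isDecEquivalence : IsDecEquivalence (RotEq {n})
  rotEq-isDecEquivalence = record
    { isEquivalence = record
      { refl  = Rotation⇒RotEq (rotation-refl _)
      ; sym   = rotEq-sym
      ; trans = λ r s → Rotation⇒RotEq (rotation-trans (RotEq⇒Rotation r) (RotEq⇒Rotation s))
      }
    ; _≟_ = rotEq?
    }

∃-map-punchIn : {k : ℕ} (i : Fin (suc k)) (xs : List (Fin (suc k))) → All (i ≢_) xs →
  ∃ λ ys → map (punchIn i) ys ≡ xs
∃-map-punchIn i []       []           = [] , refl
∃-map-punchIn i (x ∷ xs) (i≢x ∷ i≢xs) with ys , refl ← ∃-map-punchIn i xs i≢xs =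
  punchOut i≢x ∷ ys , cong (_∷ map (punchIn i) ys) (punchIn-punchOut i≢x)

Unique-∷⇒map-punchIn : {k m : ℕ} {i : Fin (suc k)} {xs : List (Fin (suc k))} →
  length (i ∷ xs) ≡ suc m × Unique (i ∷ xs) → ∃ λ ys → map (punchIn i) ys ≡ xs × length ys ≡ m × Unique ys
Unique-∷⇒map-punchIn {i = i} {xs} (len , i≢xs ∷ xs!) with ys , refl ← ∃-map-punchIn i xs i≢xs =
  ys , refl , trans (sym (length-map (punchIn i) ys)) (suc-injective len) , Unique.map⁻ xs!

IsPermStr⇒∈ : {k : ℕ} {xs : List (Fin k)} → IsPermStr k xs → (j : Fin k) → j ∈ xs
IsPermStr⇒∈ {suc k} {x ∷ xs} perm j with x ≟ᶠ j
... | yes refl = here refl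
... | no x≢j with ys , refl , ys-perm ← Unique-∷⇒map-punchIn perm =
  there (subst (_∈ map (punchIn x) ys) (punchIn-punchOut x≢j)
          (∈-map⁺ (punchIn x) (IsPermStr⇒∈ ys-perm (punchOut x≢j))))

IsMStr⇒∃∉ : {k : ℕ} {xs : List (Fin (suc k))} → IsMStr (suc k) xs → ∃ λ j → j ∉ xs
IsMStr⇒∃∉ {zero}  {[]}     _                    = Fin.zero , λ ()
IsMStr⇒∃∉ {suc k} {x ∷ xs} xs-m with ys , refl , ys-m ← Unique-∷⇒map-punchIn xs-m
  with j , j∉ys ← IsMStr⇒∃∉ ys-m
  = punchIn x j , j′∉
  where
  j′∉ : punchIn x j ∉ x ∷ map (punchIn x) ys
  j′∉ (here eq) = punchInᵢ≢i x j eq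
  j′∉ (there j′∈) with y , y∈ys , eq ← ∈-map⁻ (punchIn x) j′∈ =
    j∉ys (subst (_∈ ys) (sym (punchIn-injective x j y eq)) y∈ys)

∉-unique : {k : ℕ} {xs : List (Fin (suc k))} → IsMStr (suc k) xs →
  {i j : Fin (suc k)} → i ∉ xs → j ∉ xs → i ≡ j
∉-unique (len , xs!) {i} {j} i∉xs j∉xs with IsPermStr⇒∈ (cong suc len , All.¬Any⇒All¬ _ i∉xs ∷ xs!) j
... | here j≡i  = sym j≡i
... | there j∈  = ⊥-elim (j∉xs j∈)

module Permutations where

  open import Data.Nat using (_*_)

  consPunched : {k : ℕ} → Fin (suc k) → List (Fin k) → List (Fin (suc k))
  consPunched i ys = i ∷ map (punchIn i) ys

  consPunched-injective : {k : ℕ} {i j : Fin (suc k)} {ys zs : List (Fin k)} →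
    consPunched i ys ≡ consPunched j zs → i ≡ j × ys ≡ zs
  consPunched-injective {i = i} eq with refl ← ∷-injectiveˡ eq =
    refl , map-injective (punchIn-injective i _ _) (∷-injectiveʳ eq)

  IsPermStr-consPunched : {k : ℕ} (i : Fin (suc k)) {ys : List (Fin k)} →
    IsPermStr k ys → IsPermStr (suc k) (consPunched i ys)
  IsPermStr-consPunched i {ys} (len , ys!) =
    cong suc (trans (length-map (punchIn i) ys) len) ,
    All.map⁺ (All.universal (λ j i≡ → punchInᵢ≢i i j (sym i≡)) ys) ∷ Unique.map⁺ (punchIn-injective i _ _) ys!

  permutations : (k : ℕ) → List (List (Fin k))
  permutations zero    = [ [] ]
  permutations (suc k) = cartesianProductWith consPunched (allFin (suc k)) (permutations k)

  ∈-permutations⁻ : (k : ℕ) {xs : List (Fin k)} → xs ∈ permutations k → IsPermStr k xs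
  ∈-permutations⁻ zero    (here refl) = refl , []
  ∈-permutations⁻ (suc k) xs∈
    with i , ys , _ , ys∈ , refl ← ∈-cartesianProductWith⁻ consPunched (allFin (suc k)) (permutations k) xs∈ =
    IsPermStr-consPunched i (∈-permutations⁻ k ys∈)

  ∈-permutations⁺ : (k : ℕ) {xs : List (Fin k)} → IsPermStr k xs → xs ∈ permutations k
  ∈-permutations⁺ zero    {[]}     _ = here refl
  ∈-permutations⁺ (suc k) {i ∷ xs} perm with ys , refl , ys-perm ← Unique-∷⇒map-punchIn perm =
    ∈-cartesianProductWith⁺ consPunched (∈-allFin i) (∈-permutations⁺ k ys-perm)

  permutations-unique : (k : ℕ) → Unique (permutations k)
  permutations-unique zero    = [] ∷ []
  permutations-unique (suc k) =
    Unique.cartesianProductWith⁺ consPunched consPunched-injective (Unique.allFin⁺ (suc k)) (permutations-unique k)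

  length-permutations : (k : ℕ) → length (permutations k) ≡ k !
  length-permutations zero    = refl
  length-permutations (suc k) =
    trans (length-cartesianProductWith consPunched (allFin (suc k)) (permutations k))
          (cong₂ _*_ (length-tabulate {n = suc k} (λ i → i)) (length-permutations k))

open Permutations

wilfAdj⇒meets-shifts : {k : ℕ} {X Y : Str (suc (suc k))} {μ : Fin (suc (suc k))} →
  IsPermStr (suc (suc k)) X → IsMStr (suc (suc k)) Y → μ ∉ Y →
  WilfAdj X Y → Any (RotEq X) (map (μ ∷_) (shifts Y))
wilfAdj⇒meets-shifts {Y = []} _ (() , _)
wilfAdj⇒meets-shifts {X = X} {y ∷ ys} {μ} X-perm Y-m μ∉Y adj with find adj
... | [] , p∈ , _ with () ← proj₁ (IsPermStr-resp-rotation (RotEq⇒Rotation p∈) X-perm)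
... | h ∷ t , p∈ , t~Y =
  lose (∈-map⁺ (μ ∷_) (∈-shifts⁺ (rotation-sym t↻Y))) (subst (λ c → RotEq X (c ∷ t)) h≡μ p∈)
  where
  t↻Y : Rotation t (y ∷ ys)
  t↻Y = RotEq⇒Rotation t~Y
  h∉t : h ∉ t
  h∉t = Unique[x∷xs]⇒x∉xs (proj₂ (IsPermStr-resp-rotation (RotEq⇒Rotation p∈) X-perm))
  h≡μ : h ≡ μ
  h≡μ = ∉-unique Y-m (∉-resp-rotation t↻Y h∉t) μ∉Y

meets-shifts⇒wilfAdj : {n : ℕ} {X Y : Str n} {μ : Fin n} →
  Any (RotEq X) (map (μ ∷_) (shifts Y)) → WilfAdj X Y
meets-shifts⇒wilfAdj {μ = μ} meets
  with s , s∈ , X~s ← find meets with t , t∈ , refl ← ∈-map⁻ (μ ∷_) s∈ =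
  lose X~s (Rotation⇒RotEq (rotation-sym (∈-shifts⁻ t∈)))

module WilfGraph (k : ℕ) (Ps : List (Str (suc (suc k)))) (Ps-reps : IsPClassReps (suc (suc k)) Ps) where

  open import Data.Nat using (_*_)
  open import Data.Fin.Properties using () renaming (suc-injective to Fin-suc-injective)
  open Transversal (rotEq-isDecEquivalence {suc (suc k)})

  private
    N : ℕ
    N = suc (suc k)

  count-meeting-prefixed : (c : Fin N) (L : List (Str N)) → Unique L → All (λ l → IsPermStr N (c ∷ l)) L →
    count (λ X → any? (rotEq? X) (map (c ∷_) L)) Ps ≡ length L
  count-meeting-prefixed c L L! L-perms =
    trans (count-meeting (proj₁ (proj₂ Ps-reps)) inequivalent covered) (length-map (c ∷_) L)
    where
    inequivalent : Inequivalent (map (c ∷_) L)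
    inequivalent = AllPairs.map⁺ (allPairs-mapWith-All
      (λ (_ , cl!) _ l≢l′ cl~cl′ → l≢l′ (rotation-∷-cancel cl! (RotEq⇒Rotation cl~cl′))) L-perms L!)
    covered : All (λ s → Any (λ X → RotEq X s) Ps) (map (c ∷_) L)
    covered = All.map⁺ (All.map (λ cl-perm → Any.map rotEq-sym (proj₂ (proj₂ Ps-reps) _ cl-perm)) L-perms)

  degree : {Y : Str N} → IsMStr N Y → count (λ X → wilfAdj? (X , Y)) Ps ≡ suc k
  degree {Y} Y-m@(len , Y!) with μ , μ∉Y ← IsMStr⇒∃∉ Y-m = begin
    count (λ X → wilfAdj? (X , Y)) Ps
      ≡⟨ count-cong _ _ (All.map (λ X-perm → wilfAdj⇒meets-shifts X-perm Y-m μ∉Y , meets-shifts⇒wilfAdj)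
                                 (proj₁ Ps-reps)) ⟩
    count (λ X → any? (rotEq? X) (map (μ ∷_) (shifts Y))) Ps
      ≡⟨ count-meeting-prefixed μ (shifts Y) (shifts-unique Y!) shifts-perms ⟩
    length (shifts Y)
      ≡⟨ trans (length-shifts Y) len ⟩
    suc k ∎
    where
    open ≡-Reasoning
    shifts-perms : All (λ t → IsPermStr N (μ ∷ t)) (shifts Y)
    shifts-perms = All.tabulate λ t∈ → let Y↻t = ∈-shifts⁻ t∈ in
      cong suc (trans (length-rotation Y↻t) len) ,
      All.¬Any⇒All¬ _ (∉-resp-rotation Y↻t μ∉Y) ∷ Unique-resp-rotation Y↻t Y!

  edges : (Ys : List (Str N)) → IsMClassSubset N Ys → edgeCount Ps Ys ≡ length Ys * suc k
  edges Ys (Ys-m , _) = count-cartesianProduct-regular wilfAdj? Ps Ys (All.map degree Ys-m)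

  canonical : List (Str N)
  canonical = map (map Fin.suc) (permutations (suc k))

  meets-canonical : {X : Str N} → IsPermStr N X → Any (RotEq X) (map (Fin.zero ∷_) canonical)
  meets-canonical X-perm with a , b , refl ← ∈-∃++ (IsPermStr⇒∈ X-perm Fin.zero)
    with q , q≡ba , q-perm ← Unique-∷⇒map-punchIn (IsPermStr-resp-rotation (rotation-++-∷ a Fin.zero b) X-perm)
    = lose (subst (λ t → Fin.zero ∷ t ∈ map (Fin.zero ∷_) canonical) q≡ba
              (∈-map⁺ (Fin.zero ∷_) (∈-map⁺ (map Fin.suc) (∈-permutations⁺ (suc k) q-perm))))
           (Rotation⇒RotEq (rotation-++-∷ a Fin.zero b))

  classes : length Ps ≡ (suc k) !
  classes = begin
    length Ps
      ≡⟨ count-all _ (All.map meets-canonical (proj₁ Ps-reps)) ⟨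
    count (λ X → any? (rotEq? X) (map (Fin.zero ∷_) canonical)) Ps
      ≡⟨ count-meeting-prefixed Fin.zero canonical canonical-unique canonical-perms ⟩
    length canonical
      ≡⟨ trans (length-map (map Fin.suc) (permutations (suc k))) (length-permutations (suc k)) ⟩
    (suc k) ! ∎
    where
    open ≡-Reasoning
    canonical-unique : Unique canonical
    canonical-unique = Unique.map⁺ (map-injective Fin-suc-injective) (permutations-unique (suc k))
    canonical-perms : All (λ l → IsPermStr N (Fin.zero ∷ l)) canonical
    canonical-perms = All.map⁺ (All.tabulate λ q∈ → IsPermStr-consPunched Fin.zero (∈-permutations⁻ (suc k) q∈))

open import Data.Integer using (ℤ; +_; _-_; _+_; _*_)
import Data.Integer.Properties as ℤ
open import Data.Integer.Tactic.RingSolver using (solve-∀)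
import Data.Nat as ℕ

surplus-arithmetic : (k l f : ℕ) → (+ (l ℕ.* suc k) - + (f ℕ.+ l)) + + 1 ≡ ((+ k * + l) - + f) + + 1
surplus-arithmetic k l f = begin
  (+ (l ℕ.* suc k) - + (f ℕ.+ l)) + + 1
    ≡⟨ cong₂ (λ e v → (e - v) + + 1) (ℤ.pos-* l (suc k)) (ℤ.pos-+ f l) ⟩
  (+ l * (+ 1 + + k) - (+ f + + l)) + + 1
    ≡⟨ ring (+ k) (+ l) (+ f) ⟩
  ((+ k * + l) - + f) + + 1 ∎
  where
  open ≡-Reasoning
  ring : ∀ k l f → (l * (+ 1 + k) - (f + l)) + + 1 ≡ ((k * l) - f) + + 1
  ring = solve-∀

lemma10 : (n : ℕ) → 2 ≤ n →
    (Ps : List (Str n)) → IsPClassReps n Ps →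
    (Ys : List (Str n)) → IsMClassSubset n Ys →
    edgeSurplus Ps Ys ≡ ((+ (n ∸ 2) * + length Ys) - + ((n ∸ 1) !)) + + 1
lemma10 (suc (suc k)) (s≤s (s≤s z≤n)) Ps Ps-reps Ys Ys-m = begin
  edgeSurplus Ps Ys
    ≡⟨ cong₂ (λ e c → (+ e - + (c ℕ.+ length Ys)) + + 1) (edges Ys Ys-m) classes ⟩
  (+ (length Ys ℕ.* suc k) - + ((suc k) ! ℕ.+ length Ys)) + + 1
    ≡⟨ surplus-arithmetic k (length Ys) ((suc k) !) ⟩
  ((+ k * + length Ys) - + ((suc k) !)) + + 1 ∎
  where
  open ≡-Reasoning
  open WilfGraph k Ps Ps-reps
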